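{- Let $S_1$ be the infinite sequence in $\mathbb{Z}/4\mathbb{Z}$ $$S_1 = I\,(P_1P_2P_3)^\infty,\quad I=01220232,\ P_1=21211322,\ P_2=00302323,\ P_3=11200232,$$ and let $(x_{i,j})_{i,j\ge 1}$ be the infinite Steinhaus array generated by $S_1$, i.e. $x_{1,j}$ is the $j$-th term of $S_1$ and $x_{i+1,j}=x_{i,j}+x_{i,j+1}$; thus for every $n$, $\nabla S_1[n]=\{x_{i,j}: i+j\le n+1\}$. For $c\ge 0$ let $T_c$ be the triangular block $(x_{i,8c+j})_{(i,j)\in\Delta}$, $\Delta=\{(i,j): i,j\ge1,\ i+j\le 9\}$, and for $r\ge1$, $c\ge0$ let $L_{r,c}$ be the lozenge block $(x_{8(r-1)+i,\,8c+j})_{(i,j)\in\Lambda}$, where $\Lambda=\{(i,j): 2\le i\le 9,\ 10-i\le j\le 8\}\cup\{(i,j): 10\le i\le 16,\ 1\le j\le 17-i\}$. Two blocks of the same shape are called equal if their entries coincide at every relative position $(i,j)$. Then for every integer $k\ge 0$, the triangle $\nabla S_1[8k]$ is the disjoint union of the blocks $T_c$ ($0\le c\le k-1$) and $L_{r,c}$ ($r\ge1$, $c\ge0$, $r+c\le k-1$), and these blocks satisfy: (i) $T_0=\nabla I$ and, for $c\ge1$, $T_c=\nabla P_{((c-1)\bmod 3)+1}$; (ii) $L_{1,c}=L_{1,c-3}$ and $L_{2,c}=L_{2,c-3}$ for all $c\ge 4$; (iii) for all $r\ge 3$ and $c\ge1$, $L_{r,c}=L_{2,\,((c-r+1)\bmod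 3)+1}$; (iv) for all $r\ge5$, $L_{r,0}=L_{r-3,0}$. Moreover, with $A_0=\nabla I$, $A_i=\nabla P_i$ and the lozenges $B_0=L_{1,0}$, $B_i=L_{1,i}$, $C_0=L_{2,0}$, $C_i=L_{2,i}$ ($i=1,2,3$), $D_0=L_{3,0}$, $E_0=L_{4,0}$, one has $B_i=A_i\ast A_{i+1}$ ($i=0,1,2$), $B_3=A_3\ast A_1$, $C_i=B_i\ast B_{i+1}$ ($i=0,1,2$), $C_3=B_3\ast B_1$, $D_0=C_0\ast C_1$, $E_0=D_0\ast C_3$.
   Context: Here $\nabla W$ for a word $W$ of length 8 denotes its Steinhaus triangle (Pascal's rule mod 4). For two blocks $A,B$ (triangles or lozenges of side 8), $A\ast B$ denotes the unique lozenge they would determine by Pascal's rule if $A$ and $B$ were adjacent side by side in a large Steinhaus triangle (with $A$ on the left), i.e. the lozenge lying directly below the meeting point of $A$ and $B$, bounded above by the lower-right side of $A$ and the lower-left side of $B$; it depends only on the lower-right side of $A$ and the lower-left side of $B$. -}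

module Defs where

open import Data.Nat using (ℕ; zero; suc; _+_; _*_; _∸_; _≤_; _<_; _<?_; _≤ᵇ_; _≡ᵇ_)
open import Data.Nat.DivMod using (_/_; _mod_)
open import Data.Fin using (Fin; #_; toℕ; fromℕ<)
import Data.Fin as F
open import Data.Vec using (Vec; []; _∷_; lookup)
open import Data.Bool using (if_then_else_; _∧_)
open import Data.Product using (Σ; _×_)
open import Data.Sum using (_⊎_)
open import Data.Integer as ℤ using (ℤ; +_)
open import Data.Integer.DivMod using (_%ℕ_)
open import Relation.Nullary using (yes; no)
open import Relation.Binary.PropositionalEquality using (_≡_)

Z4 : Set
Z4 = Fin 4

_⊕_ : Z4 → Z4 → Z4
a ⊕ b = (toℕ a + toℕ b) mod 4

Word : Set
Word = Vec Z4 8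

I P1 P2 P3 : Word
I  = # 0 ∷ # 1 ∷ # 2 ∷ # 2 ∷ # 0 ∷ # 2 ∷ # 3 ∷ # 2 ∷ []
P1 = # 2 ∷ # 1 ∷ # 2 ∷ # 1 ∷ # 1 ∷ # 3 ∷ # 2 ∷ # 2 ∷ []
P2 = # 0 ∷ # 0 ∷ # 3 ∷ # 0 ∷ # 2 ∷ # 3 ∷ # 2 ∷ # 3 ∷ []
P3 = # 1 ∷ # 1 ∷ # 2 ∷ # 0 ∷ # 0 ∷ # 2 ∷ # 3 ∷ # 2 ∷ []

P : Fin 3 → Word
P F.zero = P1
P (F.suc F.zero) = P2
P (F.suc (F.suc F.zero)) = P3

-- seq n = (n+1)-th term of S₁ = I (P₁P₂P₃)^∞
seq : ℕ → Z4
seq n with n <? 8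
... | yes n<8 = lookup I (fromℕ< n<8)
... | no _    = lookup (P (((n ∸ 8) / 8) mod 3)) ((n ∸ 8) mod 8)

-- 1-indexed sequence S₁ (S₁ 0 is junk)
S1 : ℕ → Z4
S1 j = seq (j ∸ 1)

-- Steinhaus array generated by a 1-indexed first row f:
-- arr f 1 j = f j,  arr f (i+1) j = arr f i j + arr f i (j+1).  Row 0 is junk.
arr : (ℕ → Z4) → ℕ → ℕ → Z4
arr f zero j = # 0
arr f (suc zero) j = f j
arr f (suc (suc i)) j = arr f (suc i) j ⊕ arr f (suc i) (suc j)

x : ℕ → ℕ → Z4
x = arr S1

-- Steinhaus triangle ∇W of a word of length 8 (only meaningful on Δ)
nabla : Word → ℕ → ℕ → Z4
nabla W = arr (λ j → lookup W ((j ∸ 1) mod 8))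

InΔ : ℕ → ℕ → Set
InΔ i j = (1 ≤ i) × (1 ≤ j) × (i + j ≤ 9)

InΛ : ℕ → ℕ → Set
InΛ i j = ((2 ≤ i) × (i ≤ 9) × (10 ∸ i ≤ j) × (j ≤ 8))
        ⊎ ((10 ≤ i) × (i ≤ 16) × (1 ≤ j) × (j ≤ 17 ∸ i))

-- a block is given by its entries at relative positions
Block : Set
Block = ℕ → ℕ → Z4

T : ℕ → Block
T c i j = x i (8 * c + j)

L : ℕ → ℕ → Block
L r c i j = x (8 * (r ∸ 1) + i) (8 * c + j)

TriEq : Block → Block → Set
TriEq A B = ∀ i j → InΔ i j → A i j ≡ B i j

LozEq : Block → Block → Set
LozEq A B = ∀ i j → InΛ i j → A i j ≡ B i j

-- The lozenge determined by Pascal's rule from a right side a (a_1..a_8, top to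
-- bottom) of the left block, placed at relative positions (k, 9-k), and a left side
-- b (b_1..b_8) of the right block, placed at relative positions (k, 9), k = 1..8.
-- Its entries at the positions of Λ are the lozenge below the meeting point.
lz : (ℕ → Z4) → (ℕ → Z4) → Block
lz a b zero j = # 0
lz a b (suc i) j =
  if (suc i ≤ᵇ 8) ∧ (j ≡ᵇ (9 ∸ suc i)) then a (suc i)
  else if (suc i ≤ᵇ 8) ∧ (j ≡ᵇ 9) then b (suc i)
  else (lz a b i j ⊕ lz a b i (suc j))

-- A ∗ B for triangles: lower-right side of A is (k, 9-k), lower-left side of B is (k, 1)
triStar : Block → Block → Block
triStar A B = lz (λ k → A k (9 ∸ k)) (λ k → B k 1)

-- A ∗ B for lozenges: lower-right side of A is (8+k, 9-k) = (i, 17-i), i = 9..16,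
-- lower-left side of B is (8+k, 1)
lozStar : Block → Block → Block
lozStar A B = lz (λ k → A (8 + k) (9 ∸ k)) (λ k → B (8 + k) 1)

data BlockIx : Set where
  tri : ℕ → BlockIx
  loz : ℕ → ℕ → BlockIx

InBlock : BlockIx → ℕ → ℕ → Set
InBlock (tri c) i j = Σ ℕ λ j′ → (j ≡ 8 * c + j′) × InΔ i j′
InBlock (loz r c) i j = Σ ℕ λ i′ → Σ ℕ λ j′ →
  (i ≡ 8 * (r ∸ 1) + i′) × (j ≡ 8 * c + j′) × InΛ i′ j′

Valid : ℕ → BlockIx → Set
Valid k (tri c) = c < k
Valid k (loz r c) = (1 ≤ r) × (r + c < k)

InTri : ℕ → ℕ → ℕ → Set
InTri n i j = (1 ≤ i) × (1 ≤ j) × (i + j ≤ n + 1)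

DisjointUnion : ℕ → Set
DisjointUnion k =
    (∀ b → Valid k b → ∀ i j → InBlock b i j → InTri (8 * k) i j)
  × (∀ i j → InTri (8 * k) i j → Σ BlockIx λ b → Valid k b × InBlock b i j)
  × (∀ b b′ → Valid k b → Valid k b′ → ∀ i j → InBlock b i j → InBlock b′ i j → b ≡ b′)

-- ((c - r + 1) mod 3) + 1, computed in ℤ (result in {1,2,3})
idx3 : ℕ → ℕ → ℕ
idx3 r c = suc (((+ c ℤ.- + r) ℤ.+ + 1) %ℕ 3)

-- S₁ is periodic with period 24 from its ninth term on, and Pascal's rule propagates
-- the agreement of two rows (up to a column shift) to everything below them.  A finite
-- computation shows that row 17 agrees with row 9 shifted by 8 columns over one period
-- and that row 33 agrees with row 9 on its first 8 entries.  With the column periodicity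
-- this gives x(i+8, j+8) = x(i, j) for i, j ≥ 9 and x(i+24, j) = x(i, j) for i ≥ 9,
-- from which (ii)–(iv) follow.  Each T_c is the Steinhaus triangle of its top row, and
-- each lozenge is computed by Pascal's rule from its two upper sides, which gives the
-- ∗-relations.  The tiling is read off from i − 1 and j − 1 written in base 8.
module Submission where

open import Defs
open import Data.Nat using (ℕ; _≤_; _∸_)
open import Data.Nat.DivMod using (_mod_)
open import Data.Product using (_×_)

open import Data.Bool using (Bool; true; false; _∧_; if_then_else_)
import Data.Bool.Properties as Bool
open import Data.Fin as F using (Fin; toℕ; fromℕ<)
open import Data.Fin.Properties using (all?; toℕ-fromℕ<; fromℕ<-cong)
import Data.Integer as ℤ
open import Data.Integer.DivMod using (_%ℕ_)
import Data.Integer.Tactic.RingSolver as ℤ-Solver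
open import Data.List using (List; []; _∷_; length; applyUpTo)
open import Data.List.Properties using (length-applyUpTo)
open import Data.Nat
open import Data.Nat.DivMod
open import Data.Nat.Divisibility using (divides)
open import Data.Nat.Properties
open import Algebra.Properties.CommutativeSemigroup +-commutativeSemigroup
  using (x∙yz≈y∙xz; x∙yz≈z∙xy; interchange)
open import Data.Nat.Tactic.RingSolver using (solve-∀)
open import Data.Product using (Σ; _,_; proj₁; proj₂)
open import Data.Sum using (_⊎_; inj₁; inj₂)
open import Data.Vec using (lookup)
open import Relation.Binary.PropositionalEquality
open import Relation.Nullary using (Dec; yes; no; contradiction)
open import Relation.Nullary.Decidable using (from-yes; map′; _×-dec_; _⊎-dec_; _→-dec_)

-- Arrays obeying Pascal's rule

Pascal : (ℕ → ℕ → Z4) → Set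
Pascal A = ∀ {i} j → 1 ≤ i → A (suc i) j ≡ A i j ⊕ A i (suc j)

arr-pascal : ∀ f → Pascal (arr f)
arr-pascal f {suc i} j _ = refl

module _ (A B : ℕ → ℕ → Z4) (pascalA : Pascal A) (pascalB : Pascal B) where

  rows-agree : ∀ a b s s′ J K → 1 ≤ a → 1 ≤ b →
    (∀ j → J ≤ j → j ≤ K → A a (s + j) ≡ B b (s′ + j)) →
    ∀ t j → J ≤ j → j + t ≤ K → A (t + a) (s + j) ≡ B (t + b) (s′ + j)
  rows-agree a b s s′ J K a≥1 b≥1 row zero j J≤j j≤K = row j J≤j (subst (_≤ K) (+-identityʳ j) j≤K)
  rows-agree a b s s′ J K a≥1 b≥1 row (suc t) j J≤j j+t<K = begin
    A (suc t + a) (s + j)                          ≡⟨ pascalA (s + j) (≤-trans a≥1 (m≤n+m a t)) ⟩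
    A (t + a) (s + j) ⊕ A (t + a) (suc (s + j))    ≡⟨ cong₂ _⊕_ left right ⟩
    B (t + b) (s′ + j) ⊕ B (t + b) (suc (s′ + j))  ≡⟨ pascalB (s′ + j) (≤-trans b≥1 (m≤n+m b t)) ⟨
    B (suc t + b) (s′ + j)                         ∎
    where
    open ≡-Reasoning
    agree = rows-agree a b s s′ J K a≥1 b≥1 row t
    left : A (t + a) (s + j) ≡ B (t + b) (s′ + j)
    left = agree j J≤j (≤-trans (+-monoʳ-≤ j (n≤1+n t)) j+t<K)
    right : A (t + a) (suc (s + j)) ≡ B (t + b) (suc (s′ + j))
    right = subst₂ (λ u v → A (t + a) u ≡ B (t + b) v) (+-suc s j) (+-suc s′ j)
              (agree (suc j) (m≤n⇒m≤1+n J≤j) (subst (_≤ K) (+-suc j t) j+t<K))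

  rows-agree-below : ∀ d b s s′ J → 1 ≤ b →
    (∀ j → J ≤ j → A (d + b) (s + j) ≡ B b (s′ + j)) →
    ∀ i j → b ≤ i → J ≤ j → A (d + i) (s + j) ≡ B i (s′ + j)
  rows-agree-below d b s s′ J b≥1 row i j b≤i J≤j =
    subst₂ (λ u v → A u (s + j) ≡ B v (s′ + j)) rowA rowB
      (rows-agree (d + b) b s s′ J (j + t) (≤-trans b≥1 (m≤n+m b d)) b≥1 (λ j′ J≤j′ _ → row j′ J≤j′)
                  t j J≤j ≤-refl)
    where
    t = i ∸ b
    rowB : t + b ≡ i
    rowB = m∸n+n≡m b≤i
    rowA : t + (d + b) ≡ d + i
    rowA = trans (x∙yz≈y∙xz t d b) (cong (d +_) rowB)

  rows-agree-triangle : ∀ s s′ → (∀ m → 1 ≤ m → m ≤ 8 → A 1 (s + m) ≡ B 1 (s′ + m)) →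
    ∀ i j → InΔ i j → A i (s + j) ≡ B i (s′ + j)
  rows-agree-triangle s s′ row (suc t) j (_ , 1≤j , i+j≤9) =
    subst (λ i → A i (s + j) ≡ B i (s′ + j)) (+-comm t 1)
      (rows-agree 1 1 s s′ 1 8 (s≤s z≤n) (s≤s z≤n) row t j 1≤j (subst (_≤ 8) (+-comm t j) (≤-pred i+j≤9)))

at : List Z4 → ℕ → Z4
at []      _       = F.zero
at (a ∷ l) zero    = a
at (a ∷ l) (suc k) = at l k

pascalRow : List Z4 → List Z4
pascalRow (a ∷ b ∷ l) = a ⊕ b ∷ pascalRow (b ∷ l)
pascalRow _           = []

length-pascalRow : ∀ l → length (pascalRow l) ≡ length l ∸ 1
length-pascalRow []          = refl
length-pascalRow (a ∷ [])    = refl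
length-pascalRow (a ∷ b ∷ l) = cong suc (length-pascalRow (b ∷ l))

at-pascalRow : ∀ l k → suc k < length l → at (pascalRow l) k ≡ at l k ⊕ at l (suc k)
at-pascalRow (a ∷ [])    k       (s≤s ())
at-pascalRow (a ∷ b ∷ l) zero    _         = refl
at-pascalRow (a ∷ b ∷ l) (suc k) (s≤s k<n) = at-pascalRow (b ∷ l) k k<n

at-applyUpTo : ∀ (h : ℕ → Z4) n k → k < n → at (applyUpTo h n) k ≡ h k
at-applyUpTo h (suc n) zero    _         = refl
at-applyUpTo h (suc n) (suc k) (s≤s k<n) = at-applyUpTo (λ m → h (suc m)) n k k<n

rows : (ℕ → Z4) → ℕ → ℕ → List Z4
rows f n zero    = applyUpTo (λ k → f (suc k)) n
rows f n (suc t) = pascalRow (rows f n t)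

length-rows : ∀ f n t → length (rows f n t) ≡ n ∸ t
length-rows f n zero    = length-applyUpTo (λ k → f (suc k)) n
length-rows f n (suc t) = begin
  length (pascalRow (rows f n t)) ≡⟨ length-pascalRow (rows f n t) ⟩
  length (rows f n t) ∸ 1         ≡⟨ cong (_∸ 1) (length-rows f n t) ⟩
  n ∸ t ∸ 1                       ≡⟨ ∸-+-assoc n t 1 ⟩
  n ∸ (t + 1)                     ≡⟨ cong (n ∸_) (+-comm t 1) ⟩
  n ∸ suc t                       ∎
  where open ≡-Reasoning

at-rows : ∀ f n t k → k + t < n → at (rows f n t) k ≡ arr f (suc t) (suc k)
at-rows f n zero    k k<n   = at-applyUpTo (λ m → f (suc m)) n k (subst (_< n) (+-identityʳ k) k<n)
at-rows f n (suc t) k k+t<n = begin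
  at (pascalRow (rows f n t)) k                ≡⟨ at-pascalRow (rows f n t) k k<length ⟩
  at (rows f n t) k ⊕ at (rows f n t) (suc k)  ≡⟨ cong₂ _⊕_ (at-rows f n t k (<-trans (+-monoʳ-< k (n<1+n t)) k+t<n))
                                                             (at-rows f n t (suc k) (subst (_< n) (+-suc k t) k+t<n)) ⟩
  arr f (suc (suc t)) (suc k)                  ∎
  where
  open ≡-Reasoning
  k<length : suc k < length (rows f n t)
  k<length = subst (suc k <_) (sym (length-rows f n t))
               (m+n≤o⇒m≤o∸n (suc (suc k)) (subst (_≤ n) (cong suc (+-suc k t)) k+t<n))

-- Shapes, decided by enumeration

∀Fin⇒∀< : ∀ {Q : ℕ → Set} n → (∀ (k : Fin n) → Q (toℕ k)) → ∀ k → k < n → Q k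
∀Fin⇒∀< {Q} n all k k<n = subst Q (toℕ-fromℕ< k<n) (all (fromℕ< k<n))

∀Fin²⇒∀<² : ∀ {Q : ℕ → ℕ → Set} m n → (∀ (i : Fin m) (j : Fin n) → Q (toℕ i) (toℕ j)) →
  ∀ i j → i < m → j < n → Q i j
∀Fin²⇒∀<² {Q} m n all i j i<m j<n = subst₂ Q (toℕ-fromℕ< i<m) (toℕ-fromℕ< j<n) (all (fromℕ< i<m) (fromℕ< j<n))

InTri? : ∀ n i j → Dec (InTri n i j)
InTri? n i j = (1 ≤? i) ×-dec (1 ≤? j) ×-dec (i + j ≤? n + 1)

InΛ? : ∀ i j → Dec (InΛ i j)
InΛ? i j = ((2 ≤? i) ×-dec (i ≤? 9) ×-dec (10 ∸ i ≤? j) ×-dec (j ≤? 8))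
        ⊎-dec ((10 ≤? i) ×-dec (i ≤? 16) ×-dec (1 ≤? j) ×-dec (j ≤? 17 ∸ i))

Λ-bounded : ∀ {i j} → InΛ i j → i < 17 × j < 18
Λ-bounded     (inj₁ (_ , i≤9 , _ , j≤8))   = s≤s (≤-trans i≤9 (m≤m+n 9 7)) , s≤s (≤-trans j≤8 (m≤m+n 8 9))
Λ-bounded {i} (inj₂ (_ , i≤16 , _ , j≤17)) = s≤s i≤16 , s≤s (≤-trans j≤17 (m∸n≤m 17 i))

Λ-by-enumeration : ∀ {Q : ℕ → ℕ → Set} →
  (∀ (i : Fin 17) (j : Fin 18) → InΛ (toℕ i) (toℕ j) → Q (toℕ i) (toℕ j)) → ∀ {i j} → InΛ i j → Q i j
Λ-by-enumeration {Q} all {i} {j} l =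
  ∀Fin²⇒∀<² {λ i j → InΛ i j → Q i j} 17 18 all i j (proj₁ (Λ-bounded l)) (proj₂ (Λ-bounded l)) l

Λ⊆InTri16 : ∀ {i j} → InΛ i j → InTri 16 i j
Λ⊆InTri16 = Λ-by-enumeration {InTri 16}
  (from-yes (all? {n = 17} λ i → all? {n = 18} λ j → InΛ? (toℕ i) (toℕ j) →-dec InTri? 16 (toℕ i) (toℕ j)))

-- Lozenges from their upper sides

-- The region where lz a b is evaluated: Λ together with the two sides a and b.
InΛ⁺ : ℕ → ℕ → Set
InΛ⁺ i j = (1 ≤ i × i ≤ 8 × 9 ≤ i + j × j ≤ 9) ⊎ (9 ≤ i × 1 ≤ j × i + j ≤ 17)

InΛ⁺? : ∀ i j → Dec (InΛ⁺ i j)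
InΛ⁺? i j = ((1 ≤? i) ×-dec (i ≤? 8) ×-dec (9 ≤? i + j) ×-dec (j ≤? 9))
         ⊎-dec ((9 ≤? i) ×-dec (1 ≤? j) ×-dec (i + j ≤? 17))

Λ⁺-bounded : ∀ {i j} → InΛ⁺ i j → i < 18 × j < 18
Λ⁺-bounded (inj₁ (_ , i≤8 , _ , j≤9)) = s≤s (≤-trans i≤8 (m≤m+n 8 9)) , s≤s (≤-trans j≤9 (m≤m+n 9 8))
Λ⁺-bounded (inj₂ (_ , _ , i+j≤17))   = s≤s (m+n≤o⇒m≤o _ i+j≤17) , s≤s (m+n≤o⇒n≤o _ i+j≤17)

Λ⊆Λ⁺ : ∀ {i j} → InΛ i j → InΛ⁺ i j
Λ⊆Λ⁺ = Λ-by-enumeration {InΛ⁺}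
  (from-yes (all? {n = 17} λ i → all? {n = 18} λ j → InΛ? (toℕ i) (toℕ j) →-dec InΛ⁺? (toℕ i) (toℕ j)))

onSideA onSideB : ℕ → ℕ → Bool
onSideA i j = (suc i ≤ᵇ 8) ∧ (j ≡ᵇ (9 ∸ suc i))
onSideB i j = (suc i ≤ᵇ 8) ∧ (j ≡ᵇ 9)

lz-suc : ∀ a b i j → lz a b (suc i) j
  ≡ (if onSideA i j then a (suc i) else if onSideB i j then b (suc i) else (lz a b i j ⊕ lz a b i (suc j)))
lz-suc a b i j = refl

LzStep : ℕ → ℕ → Set
LzStep i j = InΛ⁺ (suc i) j →
    (onSideA i j ≡ true → j ≡ 9 ∸ suc i × suc i ≤ 8)
  × (onSideA i j ≡ false → onSideB i j ≡ true → j ≡ 9 × suc i ≤ 8)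
  × (onSideA i j ≡ false → onSideB i j ≡ false → 1 ≤ i × InΛ⁺ i j × InΛ⁺ i (suc j))

lz-step : ∀ i j → LzStep i j
lz-step i j l = ∀Fin²⇒∀<² {LzStep} 17 18 decided i j (≤-pred (proj₁ (Λ⁺-bounded l))) (proj₂ (Λ⁺-bounded l)) l
  where
  decided = from-yes (all? {n = 17} λ i → all? {n = 18} λ j → let i = toℕ i; j = toℕ j in
    InΛ⁺? (suc i) j →-dec
      (((onSideA i j Bool.≟ true) →-dec ((j ≟ 9 ∸ suc i) ×-dec (suc i ≤? 8)))
      ×-dec ((onSideA i j Bool.≟ false) →-dec ((onSideB i j Bool.≟ true) →-dec ((j ≟ 9) ×-dec (suc i ≤? 8))))
      ×-dec ((onSideA i j Bool.≟ false) →-dec ((onSideB i j Bool.≟ false) →-dec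
               ((1 ≤? i) ×-dec InΛ⁺? i j ×-dec InΛ⁺? i (suc j))))))

module _ (A : ℕ → ℕ → Z4) (pascal : Pascal A) (i₀ j₀ : ℕ) {a b : ℕ → Z4}
  (side-a : ∀ k → 1 ≤ k → k ≤ 8 → a k ≡ A (i₀ + k) (j₀ + (9 ∸ k)))
  (side-b : ∀ k → 1 ≤ k → k ≤ 8 → b k ≡ A (i₀ + k) (j₀ + 9)) where

  lz-on-Λ⁺ : ∀ i j → InΛ⁺ i j → lz a b i j ≡ A (i₀ + i) (j₀ + j)
  lz-on-Λ⁺ zero j (inj₁ (() , _))
  lz-on-Λ⁺ zero j (inj₂ (() , _))
  lz-on-Λ⁺ (suc i) j l rewrite lz-suc a b i j with onSideA i j in onA
  ... | true = let j≡ , i<8 = proj₁ (lz-step i j l) onA in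
    subst (λ j → a (suc i) ≡ A (i₀ + suc i) (j₀ + j)) (sym j≡) (side-a (suc i) (s≤s z≤n) i<8)
  ... | false with onSideB i j in onB
  ...   | true = let j≡ , i<8 = proj₁ (proj₂ (lz-step i j l)) onA onB in
    subst (λ j → b (suc i) ≡ A (i₀ + suc i) (j₀ + j)) (sym j≡) (side-b (suc i) (s≤s z≤n) i<8)
  ...   | false = let 1≤i , l₁ , l₂ = proj₂ (proj₂ (lz-step i j l)) onA onB in begin
    lz a b i j ⊕ lz a b i (suc j)                    ≡⟨ cong₂ _⊕_ (lz-on-Λ⁺ i j l₁) (lz-on-Λ⁺ i (suc j) l₂) ⟩
    A (i₀ + i) (j₀ + j) ⊕ A (i₀ + i) (j₀ + suc j)    ≡⟨ cong (λ m → A (i₀ + i) (j₀ + j) ⊕ A (i₀ + i) m) (+-suc j₀ j) ⟩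
    A (i₀ + i) (j₀ + j) ⊕ A (i₀ + i) (suc (j₀ + j))  ≡⟨ pascal (j₀ + j) (≤-trans 1≤i (m≤n+m i i₀)) ⟨
    A (suc (i₀ + i)) (j₀ + j)                        ≡⟨ cong (λ m → A m (j₀ + j)) (+-suc i₀ i) ⟨
    A (i₀ + suc i) (j₀ + j)                          ∎
    where open ≡-Reasoning

  lz-sides : ∀ i j → InΛ i j → lz a b i j ≡ A (i₀ + i) (j₀ + j)
  lz-sides i j l = lz-on-Λ⁺ i j (Λ⊆Λ⁺ l)

-- Base 8 and the sequence S₁

data Base8 : ℕ → Set where
  digits : ∀ a p → p < 8 → Base8 (8 * a + suc p)

base8 : ∀ n → 1 ≤ n → Base8 n
base8 (suc n) _ = subst Base8 n-digits (digits (n / 8) (n % 8) (m%n<n n 8))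
  where
  open ≡-Reasoning
  n-digits : 8 * (n / 8) + suc (n % 8) ≡ suc n
  n-digits = begin
    8 * (n / 8) + suc (n % 8)   ≡⟨ +-suc (8 * (n / 8)) (n % 8) ⟩
    suc (8 * (n / 8) + n % 8)   ≡⟨ cong suc (+-comm (8 * (n / 8)) (n % 8)) ⟩
    suc (n % 8 + 8 * (n / 8))   ≡⟨ cong (λ m → suc (n % 8 + m)) (*-comm 8 (n / 8)) ⟩
    suc (n % 8 + n / 8 * 8)     ≡⟨ cong suc (m≡m%n+[m/n]*n n 8) ⟨
    suc n                       ∎

[8*a+p]/8≡a : ∀ a {p} → p < 8 → (8 * a + p) / 8 ≡ a
[8*a+p]/8≡a a {p} p<8 = begin
  (8 * a + p) / 8    ≡⟨ +-distrib-/-∣ˡ p (divides a (*-comm 8 a)) ⟩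
  8 * a / 8 + p / 8  ≡⟨ cong₂ _+_ (trans (cong (_/ 8) (*-comm 8 a)) (m*n/n≡m a 8)) (m<n⇒m/n≡0 p<8) ⟩
  a + 0              ≡⟨ +-identityʳ a ⟩
  a                  ∎
  where open ≡-Reasoning

[8*a+p]%8≡p : ∀ a {p} → p < 8 → (8 * a + p) % 8 ≡ p
[8*a+p]%8≡p a {p} p<8 = begin
  (8 * a + p) % 8  ≡⟨ cong (_% 8) (trans (+-comm (8 * a) p) (cong (p +_) (*-comm 8 a))) ⟩
  (p + a * 8) % 8  ≡⟨ [m+kn]%n≡m%n p a 8 ⟩
  p % 8            ≡⟨ m<n⇒m%n≡m p<8 ⟩
  p                ∎
  where open ≡-Reasoning

digits-injective : ∀ {a a′ p p′} → p < 8 → p′ < 8 → 8 * a + suc p ≡ 8 * a′ + suc p′ → a ≡ a′ × p ≡ p′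
digits-injective {a} {a′} {p} {p′} p<8 p′<8 eq =
    trans (sym ([8*a+p]/8≡a a p<8)) (trans (cong (_/ 8) eq′) ([8*a+p]/8≡a a′ p′<8))
  , trans (sym ([8*a+p]%8≡p a p<8)) (trans (cong (_% 8) eq′) ([8*a+p]%8≡p a′ p′<8))
  where
  eq′ : 8 * a + p ≡ 8 * a′ + p′
  eq′ = suc-injective (trans (sym (+-suc (8 * a) p)) (trans eq (+-suc (8 * a′) p′)))

8*[m+n]+k≡8*m+[8*n+k] : ∀ m n k → 8 * (m + n) + k ≡ 8 * m + (8 * n + k)
8*[m+n]+k≡8*m+[8*n+k] m n k = trans (cong (_+ k) (*-distribˡ-+ 8 m n)) (+-assoc (8 * m) (8 * n) k)

8*[1+a]+[1+p]≡8*a+[9+p] : ∀ a p → 8 * suc a + suc p ≡ 8 * a + (9 + p)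
8*[1+a]+[1+p]≡8*a+[9+p] a p = trans (8*[m+n]+k≡8*m+[8*n+k] 1 a (suc p)) (x∙yz≈y∙xz 8 (8 * a) (suc p))

9≤8*a+k : ∀ {a k} → 1 ≤ a → 1 ≤ k → 9 ≤ 8 * a + k
9≤8*a+k 1≤a 1≤k = +-mono-≤ (*-monoʳ-≤ 8 1≤a) 1≤k

1≤8*a+k : ∀ a {k} → 1 ≤ k → 1 ≤ 8 * a + k
1≤8*a+k a {k} 1≤k = ≤-trans 1≤k (m≤n+m k (8 * a))

S1-initial : ∀ q → q < 8 → S1 (suc q) ≡ lookup I (q mod 8)
S1-initial q q<8 with q <? 8
... | yes q<8′ = cong (lookup I) (fromℕ<-cong q (q % 8) (sym (m<n⇒m%n≡m q<8)) q<8′ (m%n<n q 8))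
... | no  q≮8  = contradiction q<8 q≮8

S1-P : ∀ c {q} → q < 8 → S1 (8 * suc c + suc q) ≡ lookup (P (c mod 3)) (q mod 8)
S1-P c {q} q<8 = begin
  S1 (8 * suc c + suc q)                ≡⟨ cong (λ n → seq (n ∸ 1)) (+-suc (8 * suc c) q) ⟩
  seq (8 * suc c + q)                   ≡⟨ cong seq (8*[m+n]+k≡8*m+[8*n+k] 1 c q) ⟩
  seq (8 + n)                           ≡⟨⟩
  lookup (P ((n / 8) mod 3)) (n mod 8)  ≡⟨ cong₂ (λ b m → lookup (P (b mod 3)) m) ([8*a+p]/8≡a c q<8) n-mod ⟩
  lookup (P (c mod 3)) (q mod 8)        ∎
  where
  open ≡-Reasoning
  n = 8 * c + q
  n-mod : n mod 8 ≡ q mod 8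
  n-mod = fromℕ<-cong (n % 8) (q % 8) (trans ([8*a+p]%8≡p c q<8) (sym (m<n⇒m%n≡m q<8))) _ _

S1-periodic : ∀ j → 9 ≤ j → S1 (24 + j) ≡ S1 j
S1-periodic j 9≤j with base8 j (≤-trans (s≤s z≤n) 9≤j)
... | digits zero    p p<8 = contradiction 9≤j (<⇒≱ (s≤s p<8))
... | digits (suc c) p p<8 = begin
  S1 (24 + (8 * suc c + suc p))         ≡⟨ cong S1 (8*[m+n]+k≡8*m+[8*n+k] 3 (suc c) (suc p)) ⟨
  S1 (8 * suc (3 + c) + suc p)          ≡⟨ S1-P (3 + c) p<8 ⟩
  lookup (P ((3 + c) mod 3)) (p mod 8)  ≡⟨ cong (λ b → lookup (P b) (p mod 8)) (fromℕ<-cong ((3 + c) % 3) (c % 3) refl _ _) ⟩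
  lookup (P (c mod 3)) (p mod 8)        ≡⟨ S1-P c p<8 ⟨
  S1 (8 * suc c + suc p)                ∎
  where open ≡-Reasoning

-- The array x

table : ℕ → List Z4
table = rows S1 56

-- An opaque copy of x.  Comparing two entries of x whose indices are equal but written
-- differently would make the type checker evaluate the array above them.
opaque
  X : ℕ → ℕ → Z4
  X = x

opaque
  unfolding X

  X≡x : ∀ i j → X i j ≡ x i j
  X≡x i j = refl

  X-pascal : Pascal X
  X-pascal = arr-pascal S1

  X-row1 : ∀ j → X 1 j ≡ S1 j
  X-row1 j = refl

  X≡table : ∀ t k → k + t < 56 → X (suc t) (suc k) ≡ at (table t) k
  X≡table t k k+t<56 = sym (at-rows S1 56 t k k+t<56)

X-col-periodic : ∀ i j → 1 ≤ i → 9 ≤ j → X i (24 + j) ≡ X i j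
X-col-periodic = rows-agree-below X X X-pascal X-pascal 0 1 24 0 9 (s≤s z≤n) row1
  where
  row1 : ∀ j → 9 ≤ j → X 1 (24 + j) ≡ X 1 j
  row1 j 9≤j = trans (X-row1 (24 + j)) (trans (S1-periodic j 9≤j) (sym (X-row1 j)))

X-col-periodic* : ∀ q i j → 1 ≤ i → 9 ≤ j → X i (q * 24 + j) ≡ X i j
X-col-periodic* zero    i j 1≤i 9≤j = refl
X-col-periodic* (suc q) i j 1≤i 9≤j = begin
  X i (24 + q * 24 + j)    ≡⟨ cong (X i) (+-assoc 24 (q * 24) j) ⟩
  X i (24 + (q * 24 + j))  ≡⟨ X-col-periodic i (q * 24 + j) 1≤i (≤-trans 9≤j (m≤n+m j (q * 24))) ⟩
  X i (q * 24 + j)         ≡⟨ X-col-periodic* q i j 1≤i 9≤j ⟩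
  X i j                    ∎
  where open ≡-Reasoning

row17≡row9-on-a-period : ∀ r → r < 24 → X 17 (17 + r) ≡ X 9 (9 + r)
row17≡row9-on-a-period r r<24 = begin
  X 17 (17 + r)           ≡⟨ X≡table 16 (16 + r) (+-monoˡ-< 16 (+-monoʳ-< 16 r<24)) ⟩
  at (table 16) (16 + r)  ≡⟨ ∀Fin⇒∀< {λ r → at (table 16) (16 + r) ≡ at (table 8) (8 + r)} 24 computed r r<24 ⟩
  at (table 8) (8 + r)    ≡⟨ X≡table 8 (8 + r) (+-monoˡ-< 8 (+-monoʳ-< 8 (≤-trans r<24 (m≤m+n 24 16)))) ⟨
  X 9 (9 + r)             ∎
  where
  open ≡-Reasoning
  computed : ∀ (r : Fin 24) → at (table 16) (16 + toℕ r) ≡ at (table 8) (8 + toℕ r)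
  computed = from-yes (all? {n = 24} λ r → at (table 16) (16 + toℕ r) F.≟ at (table 8) (8 + toℕ r))

X-diagonal-row : ∀ j → 9 ≤ j → X 17 (8 + j) ≡ X 9 j
X-diagonal-row j 9≤j = begin
  X 17 (8 + j)              ≡⟨ cong (X 17) (trans (cong (8 +_) j≡) (x∙yz≈y∙xz 8 (q * 24) (9 + r))) ⟩
  X 17 (q * 24 + (17 + r))  ≡⟨ X-col-periodic* q 17 (17 + r) (s≤s z≤n) (m≤m+n 9 (8 + r)) ⟩
  X 17 (17 + r)             ≡⟨ row17≡row9-on-a-period r (m%n<n m 24) ⟩
  X 9 (9 + r)               ≡⟨ X-col-periodic* q 9 (9 + r) (s≤s z≤n) (m≤m+n 9 r) ⟨
  X 9 (q * 24 + (9 + r))    ≡⟨ cong (X 9) j≡ ⟨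
  X 9 j                     ∎
  where
  open ≡-Reasoning
  m = j ∸ 9
  r = m % 24
  q = m / 24
  j≡ : j ≡ q * 24 + (9 + r)
  j≡ = begin
    j                 ≡⟨ m+[n∸m]≡n 9≤j ⟨
    9 + m             ≡⟨ cong (9 +_) (m≡m%n+[m/n]*n m 24) ⟩
    9 + (r + q * 24)  ≡⟨ x∙yz≈z∙xy 9 r (q * 24) ⟩
    q * 24 + (9 + r)  ∎

X-diagonal : ∀ i j → 9 ≤ i → 9 ≤ j → X (8 + i) (8 + j) ≡ X i j
X-diagonal = rows-agree-below X X X-pascal X-pascal 8 9 8 0 9 (s≤s z≤n) X-diagonal-row

row33≡row9 : ∀ j → 1 ≤ j → X 33 j ≡ X 9 j
row33≡row9 (suc k) _ with k <? 8
... | yes k<8 = begin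
  X 33 (suc k)     ≡⟨ X≡table 32 k (+-monoˡ-< 32 (≤-trans k<8 (m≤m+n 8 16))) ⟩
  at (table 32) k  ≡⟨ ∀Fin⇒∀< {λ k → at (table 32) k ≡ at (table 8) k} 8 computed k k<8 ⟩
  at (table 8) k   ≡⟨ X≡table 8 k (+-monoˡ-< 8 (≤-trans k<8 (m≤m+n 8 40))) ⟨
  X 9 (suc k)      ∎
  where
  open ≡-Reasoning
  computed : ∀ (k : Fin 8) → at (table 32) (toℕ k) ≡ at (table 8) (toℕ k)
  computed = from-yes (all? {n = 8} λ k → at (table 32) (toℕ k) F.≟ at (table 8) (toℕ k))
... | no k≮8 = begin
  X 33 j         ≡⟨ X-col-periodic 33 j (s≤s z≤n) 9≤j ⟨
  X 33 (24 + j)  ≡⟨ X-diagonal 25 (16 + j) (m≤m+n 9 16) (≤-trans 9≤j (m≤n+m j 16)) ⟩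
  X 25 (16 + j)  ≡⟨ X-diagonal 17 (8 + j) (m≤m+n 9 8) (≤-trans 9≤j (m≤n+m j 8)) ⟩
  X 17 (8 + j)   ≡⟨ X-diagonal-row j 9≤j ⟩
  X 9 j          ∎
  where
  open ≡-Reasoning
  j = suc k
  9≤j : 9 ≤ j
  9≤j = s≤s (≮⇒≥ k≮8)

X-row-periodic : ∀ i j → 9 ≤ i → 1 ≤ j → X (24 + i) j ≡ X i j
X-row-periodic = rows-agree-below X X X-pascal X-pascal 24 9 0 0 1 (s≤s z≤n) row33≡row9

-- Triangles and lozenges

T≡nabla : ∀ c W → (∀ m → 1 ≤ m → m ≤ 8 → S1 (8 * c + m) ≡ nabla W 1 m) → TriEq (T c) (nabla W)
T≡nabla c W row i j Δ = trans (sym (X≡x i (8 * c + j)))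
  (rows-agree-triangle X (nabla W) X-pascal (arr-pascal _) (8 * c) 0
    (λ m 1≤m m≤8 → trans (X-row1 (8 * c + m)) (row m 1≤m m≤8)) i j Δ)

T0≡∇I : TriEq (T 0) (nabla I)
T0≡∇I = T≡nabla 0 I λ { (suc q) _ q<8 → S1-initial q q<8 }

T≡∇P : ∀ c → 1 ≤ c → TriEq (T c) (nabla (P ((c ∸ 1) mod 3)))
T≡∇P (suc c) _ = T≡nabla (suc c) (P (c mod 3)) λ { (suc q) _ q<8 → S1-P c q<8 }

L′ : ℕ → ℕ → Block
L′ r c i j = X (8 * (r ∸ 1) + i) (8 * c + j)

L′⇒L : ∀ r c r′ c′ → LozEq (L′ r c) (L′ r′ c′) → LozEq (L r c) (L r′ c′)
L′⇒L r c r′ c′ eq i j Λ =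
  trans (sym (X≡x (8 * (r ∸ 1) + i) (8 * c + j))) (trans (eq i j Λ) (X≡x (8 * (r′ ∸ 1) + i) (8 * c′ + j)))

LozEq-trans : ∀ {A B C} → LozEq A B → LozEq B C → LozEq A C
LozEq-trans A≡B B≡C i j Λ = trans (A≡B i j Λ) (B≡C i j Λ)

LozEq-sym : ∀ {A B} → LozEq A B → LozEq B A
LozEq-sym A≡B i j Λ = sym (A≡B i j Λ)

L′-col-periodic : ∀ r c → 1 ≤ c → LozEq (L′ r (3 + c)) (L′ r c)
L′-col-periodic r c 1≤c i j Λ = begin
  X (8 * (r ∸ 1) + i) (8 * (3 + c) + j)   ≡⟨ cong (X (8 * (r ∸ 1) + i)) (8*[m+n]+k≡8*m+[8*n+k] 3 c j) ⟩
  X (8 * (r ∸ 1) + i) (24 + (8 * c + j))  ≡⟨ X-col-periodic _ _ (1≤8*a+k (r ∸ 1) 1≤i) (9≤8*a+k 1≤c 1≤j) ⟩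
  X (8 * (r ∸ 1) + i) (8 * c + j)         ∎
  where
  open ≡-Reasoning
  1≤i = proj₁ (Λ⊆InTri16 Λ)
  1≤j = proj₁ (proj₂ (Λ⊆InTri16 Λ))

L′-diagonal : ∀ r c → 2 ≤ r → 1 ≤ c → LozEq (L′ (suc r) (suc c)) (L′ r c)
L′-diagonal (suc r) c (s≤s 1≤r) 1≤c i j Λ = begin
  X (8 * (1 + r) + i) (8 * (1 + c) + j)  ≡⟨ cong₂ X (8*[m+n]+k≡8*m+[8*n+k] 1 r i) (8*[m+n]+k≡8*m+[8*n+k] 1 c j) ⟩
  X (8 + (8 * r + i)) (8 + (8 * c + j))  ≡⟨ X-diagonal _ _ (9≤8*a+k 1≤r 1≤i) (9≤8*a+k 1≤c 1≤j) ⟩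
  X (8 * r + i) (8 * c + j)              ∎
  where
  open ≡-Reasoning
  1≤i = proj₁ (Λ⊆InTri16 Λ)
  1≤j = proj₁ (proj₂ (Λ⊆InTri16 Λ))

L′-row-periodic : ∀ r c → 5 ≤ r → LozEq (L′ r c) (L′ (r ∸ 3) c)
L′-row-periodic (suc (suc (suc (suc s)))) c (s≤s (s≤s (s≤s (s≤s 1≤s)))) i j Λ = begin
  X (8 * (3 + s) + i) (8 * c + j)   ≡⟨ cong (λ m → X m (8 * c + j)) (8*[m+n]+k≡8*m+[8*n+k] 3 s i) ⟩
  X (24 + (8 * s + i)) (8 * c + j)  ≡⟨ X-row-periodic _ _ (9≤8*a+k 1≤s 1≤i) (1≤8*a+k c 1≤j) ⟩
  X (8 * s + i) (8 * c + j)         ∎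
  where
  open ≡-Reasoning
  1≤i = proj₁ (Λ⊆InTri16 Λ)
  1≤j = proj₁ (proj₂ (Λ⊆InTri16 Λ))

[z+3]%ℕ3≡z%ℕ3 : ∀ z → (z ℤ.+ ℤ.+ 3) %ℕ 3 ≡ z %ℕ 3
[z+3]%ℕ3≡z%ℕ3 (ℤ.+ n)                    = [m+n]%n≡m%n n 3
[z+3]%ℕ3≡z%ℕ3 ℤ.-[1+ 0 ]                 = refl
[z+3]%ℕ3≡z%ℕ3 ℤ.-[1+ 1 ]                 = refl
[z+3]%ℕ3≡z%ℕ3 ℤ.-[1+ 2 ]                 = refl
[z+3]%ℕ3≡z%ℕ3 ℤ.-[1+ suc (suc (suc n)) ] = refl

idx3-suc-suc : ∀ r c → idx3 (suc r) (suc c) ≡ idx3 r c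
idx3-suc-suc r c = cong (λ z → suc (z %ℕ 3)) (shift (ℤ.+ c) (ℤ.+ r))
  where
  shift : ∀ c r → (ℤ.+ 1 ℤ.+ c ℤ.- (ℤ.+ 1 ℤ.+ r)) ℤ.+ ℤ.+ 1 ≡ (c ℤ.- r) ℤ.+ ℤ.+ 1
  shift = ℤ-Solver.solve-∀

idx3-+3 : ∀ r c → idx3 r (3 + c) ≡ idx3 r c
idx3-+3 r c = cong suc (trans (cong (_%ℕ 3) (shift (ℤ.+ c) (ℤ.+ r))) ([z+3]%ℕ3≡z%ℕ3 (ℤ.+ c ℤ.- ℤ.+ r ℤ.+ ℤ.+ 1)))
  where
  shift : ∀ c r → (ℤ.+ 3 ℤ.+ c ℤ.- r) ℤ.+ ℤ.+ 1 ≡ ((c ℤ.- r) ℤ.+ ℤ.+ 1) ℤ.+ ℤ.+ 3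
  shift = ℤ-Solver.solve-∀

L′-row2-col≡idx3 : ∀ c → 1 ≤ c → LozEq (L′ 2 c) (L′ 2 (idx3 2 c))
L′-row2-col≡idx3 1 _ _ _ _ = refl
L′-row2-col≡idx3 2 _ _ _ _ = refl
L′-row2-col≡idx3 3 _ _ _ _ = refl
L′-row2-col≡idx3 (suc (suc (suc (suc c)))) _ = subst (λ u → LozEq (L′ 2 (4 + c)) (L′ 2 u)) (sym (idx3-+3 2 (suc c)))
  (LozEq-trans (L′-col-periodic 2 (suc c) (s≤s z≤n)) (L′-row2-col≡idx3 (suc c) (s≤s z≤n)))

L′-col≡idx3 : ∀ n c → 1 ≤ c → LozEq (L′ (2 + n) c) (L′ 2 (idx3 (2 + n) c))
L′-col≡idx3 zero    c 1≤c = L′-row2-col≡idx3 c 1≤c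
L′-col≡idx3 (suc n) c 1≤c = subst (λ u → LozEq (L′ (3 + n) c) (L′ 2 u)) idx
  (LozEq-trans (LozEq-sym (L′-col-periodic (3 + n) c 1≤c))
  (LozEq-trans (L′-diagonal (2 + n) (2 + c) (s≤s (s≤s z≤n)) (s≤s z≤n))
               (L′-col≡idx3 n (2 + c) (s≤s z≤n))))
  where
  idx : idx3 (2 + n) (2 + c) ≡ idx3 (3 + n) c
  idx = trans (sym (idx3-suc-suc (2 + n) (2 + c))) (idx3-+3 (3 + n) c)

L-col-periodic : ∀ r c → 4 ≤ c → LozEq (L r c) (L r (c ∸ 3))
L-col-periodic r (suc (suc (suc c))) (s≤s (s≤s (s≤s 1≤c))) = L′⇒L r (3 + c) r c (L′-col-periodic r c 1≤c)

L-col≡idx3 : ∀ r c → 3 ≤ r → 1 ≤ c → LozEq (L r c) (L 2 (idx3 r c))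
L-col≡idx3 1                   c (s≤s ())             _
L-col≡idx3 2                   c (s≤s (s≤s ()))       _
L-col≡idx3 (suc (suc (suc n))) c _ 1≤c = L′⇒L (3 + n) c 2 (idx3 (3 + n) c) (L′-col≡idx3 (suc n) c 1≤c)

L-row-periodic : ∀ r c → 5 ≤ r → LozEq (L r c) (L (r ∸ 3) c)
L-row-periodic r c 5≤r = L′⇒L r c (r ∸ 3) c (L′-row-periodic r c 5≤r)

-- The ∗-relations

Δ-sides : ∀ k → 1 ≤ k → k ≤ 8 → InΔ k (9 ∸ k) × InΔ k 1
Δ-sides k 1≤k k≤8 = (1≤k , m<n⇒0<n∸m (s≤s k≤8) , ≤-reflexive (m+[n∸m]≡n (m≤n⇒m≤1+n k≤8)))
                  , (1≤k , ≤-refl , +-monoˡ-≤ 1 k≤8)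

L-triStar : ∀ c A B → TriEq (T c) A → TriEq (T (suc c)) B → LozEq (L 1 c) (triStar A B)
L-triStar c A B TA TB i j Λ = begin
  x (8 * (1 ∸ 1) + i) (8 * c + j)  ≡⟨ X≡x (8 * (1 ∸ 1) + i) (8 * c + j) ⟨
  X (8 * (1 ∸ 1) + i) (8 * c + j)  ≡⟨ lz-sides X X-pascal (8 * (1 ∸ 1)) (8 * c) side-a side-b i j Λ ⟨
  triStar A B i j                  ∎
  where
  open ≡-Reasoning
  side-a : ∀ k → 1 ≤ k → k ≤ 8 → A k (9 ∸ k) ≡ X (8 * (1 ∸ 1) + k) (8 * c + (9 ∸ k))
  side-a k 1≤k k≤8 = sym (trans (X≡x k (8 * c + (9 ∸ k))) (TA k (9 ∸ k) (proj₁ (Δ-sides k 1≤k k≤8))))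
  side-b : ∀ k → 1 ≤ k → k ≤ 8 → B k 1 ≡ X (8 * (1 ∸ 1) + k) (8 * c + 9)
  side-b k 1≤k k≤8 = sym (begin
    X k (8 * c + 9)        ≡⟨ cong (X k) (x∙yz≈y∙xz 8 (8 * c) 1) ⟨
    X k (8 + (8 * c + 1))  ≡⟨ cong (X k) (8*[m+n]+k≡8*m+[8*n+k] 1 c 1) ⟨
    X k (8 * suc c + 1)    ≡⟨ X≡x k (8 * suc c + 1) ⟩
    x k (8 * suc c + 1)    ≡⟨ TB k 1 (proj₂ (Δ-sides k 1≤k k≤8)) ⟩
    B k 1                  ∎)

-- The rows r₀ and r₁ = r₀ + 1 are separate arguments so that instances such as L 4 0
-- are matched syntactically: unifying L (suc 3) with L 4 would evaluate the array.
L-lozStar : ∀ r₀ r₁ c r′ c′ → r₁ ≡ suc r₀ → 1 ≤ r₀ →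
  (∀ k → 1 ≤ k → k ≤ 8 → X (8 * (r′ ∸ 1) + (8 + k)) (8 * c′ + 1) ≡ X (8 * r₀ + k) (8 * c + 9)) →
  LozEq (L r₁ c) (lozStar (L r₀ c) (L r′ c′))
L-lozStar (suc r) _ c r′ c′ refl _ left-side i j Λ = begin
  x (8 * (2 + r ∸ 1) + i) (8 * c + j)  ≡⟨ X≡x (8 * (2 + r ∸ 1) + i) (8 * c + j) ⟨
  X (8 * (2 + r ∸ 1) + i) (8 * c + j)  ≡⟨ lz-sides X X-pascal (8 * (2 + r ∸ 1)) (8 * c) side-a side-b i j Λ ⟨
  lozStar (L (suc r) c) (L r′ c′) i j  ∎
  where
  open ≡-Reasoning
  side-a : ∀ k → 1 ≤ k → k ≤ 8 → L (suc r) c (8 + k) (9 ∸ k) ≡ X (8 * (2 + r ∸ 1) + k) (8 * c + (9 ∸ k))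
  side-a k _ _ = begin
    x (8 * (suc r ∸ 1) + (8 + k)) (8 * c + (9 ∸ k))  ≡⟨ X≡x (8 * (suc r ∸ 1) + (8 + k)) (8 * c + (9 ∸ k)) ⟨
    X (8 * r + (8 + k)) (8 * c + (9 ∸ k))            ≡⟨ cong (λ m → X m (8 * c + (9 ∸ k))) (x∙yz≈y∙xz (8 * r) 8 k) ⟩
    X (8 + (8 * r + k)) (8 * c + (9 ∸ k))            ≡⟨ cong (λ m → X m (8 * c + (9 ∸ k))) (8*[m+n]+k≡8*m+[8*n+k] 1 r k) ⟨
    X (8 * suc r + k) (8 * c + (9 ∸ k))              ∎
  side-b : ∀ k → 1 ≤ k → k ≤ 8 → L r′ c′ (8 + k) 1 ≡ X (8 * (2 + r ∸ 1) + k) (8 * c + 9)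
  side-b k 1≤k k≤8 = trans (sym (X≡x (8 * (r′ ∸ 1) + (8 + k)) (8 * c′ + 1))) (left-side k 1≤k k≤8)

-- The tiling

-- Cells of Λ in terms of in-block digits p, q < 8: the upper part of a lozenge lies in
-- one 8 × 8 block of the array, its lower part in the block below.
data ΛCell : ℕ → ℕ → Set where
  upper : ∀ {p q} → p < 8 → q < 8 → 8 ≤ p + q → ΛCell (suc p) (suc q)
  lower : ∀ {p q} → p + q < 8 → ΛCell (9 + p) (suc q)

ΛCell? : ∀ i j → Dec (ΛCell i j)
ΛCell? zero    j       = no λ ()
ΛCell? (suc p) zero    = no λ ()
ΛCell? (suc p) (suc q) =
  map′ from to (((p <? 8) ×-dec (q <? 8) ×-dec (8 ≤? p + q)) ⊎-dec ((8 ≤? p) ×-dec (p ∸ 8 + q <? 8)))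
  where
  from : (p < 8 × q < 8 × 8 ≤ p + q) ⊎ (8 ≤ p × p ∸ 8 + q < 8) → ΛCell (suc p) (suc q)
  from (inj₁ (p<8 , q<8 , 8≤p+q)) = upper p<8 q<8 8≤p+q
  from (inj₂ (8≤p , p∸8+q<8)) with m≤n⇒∃[o]m+o≡n 8≤p
  ... | _ , refl = lower p∸8+q<8
  to : ΛCell (suc p) (suc q) → (p < 8 × q < 8 × 8 ≤ p + q) ⊎ (8 ≤ p × p ∸ 8 + q < 8)
  to (upper p<8 q<8 8≤p+q) = inj₁ (p<8 , q<8 , 8≤p+q)
  to (lower {p′} p′+q<8)   = inj₂ (m≤m+n 8 p′ , p′+q<8)

ΛCell-bounded : ∀ {i j} → ΛCell i j → i < 17 × j < 18
ΛCell-bounded (upper p<8 q<8 _) = s≤s (≤-trans p<8 (m≤m+n 8 8)) , s≤s (≤-trans q<8 (m≤m+n 8 9))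
ΛCell-bounded (lower {p} {q} p+q<8) =
  +-monoʳ-< 9 (≤-<-trans (m≤m+n p q) p+q<8) , s≤s (≤-trans (≤-<-trans (m≤n+m q p) p+q<8) (m≤m+n 8 9))

Λ⇒ΛCell : ∀ {i j} → InΛ i j → ΛCell i j
Λ⇒ΛCell = Λ-by-enumeration {ΛCell}
  (from-yes (all? {n = 17} λ i → all? {n = 18} λ j → InΛ? (toℕ i) (toℕ j) →-dec ΛCell? (toℕ i) (toℕ j)))

ΛCell⇒Λ : ∀ {i j} → ΛCell i j → InΛ i j
ΛCell⇒Λ {i} {j} c = ∀Fin²⇒∀<² {λ i j → ΛCell i j → InΛ i j} 17 18 decided i j
  (proj₁ (ΛCell-bounded c)) (proj₂ (ΛCell-bounded c)) c
  where
  decided = from-yes (all? {n = 17} λ i → all? {n = 18} λ j → ΛCell? (toℕ i) (toℕ j) →-dec InΛ? (toℕ i) (toℕ j))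

Δ⇒digits : ∀ {p q} → InΔ (suc p) (suc q) → p + q < 8
Δ⇒digits {p} {q} (_ , _ , s≤s h) = subst (_≤ 8) (+-suc p q) h

digits⇒Δ : ∀ {p q} → p + q < 8 → InΔ (suc p) (suc q)
digits⇒Δ {p} {q} h = s≤s z≤n , s≤s z≤n , s≤s (subst (_≤ 8) (sym (+-suc p q)) h)

lowerBlock : ℕ → ℕ → BlockIx
lowerBlock zero    b = tri b
lowerBlock (suc a) b = loz (suc a) b

-- The block containing the cell (8a + 1 + p, 8b + 1 + q) for p, q < 8
blockAt : ℕ → ℕ → ℕ → ℕ → BlockIx
blockAt a p b q with 8 ≤? p + q
... | yes _ = loz (suc a) b
... | no  _ = lowerBlock a b

blockAt-upper : ∀ a p b q → 8 ≤ p + q → blockAt a p b q ≡ loz (suc a) b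
blockAt-upper a p b q 8≤p+q with 8 ≤? p + q
... | yes _   = refl
... | no  8≰ = contradiction 8≤p+q 8≰

blockAt-lower : ∀ a p b q → p + q < 8 → blockAt a p b q ≡ lowerBlock a b
blockAt-lower a p b q p+q<8 with 8 ≤? p + q
... | yes 8≤ = contradiction 8≤ (<⇒≱ p+q<8)
... | no  _  = refl

blockAt-covers : ∀ a p b q → p < 8 → q < 8 → InBlock (blockAt a p b q) (8 * a + suc p) (8 * b + suc q)
blockAt-covers a p b q p<8 q<8 with 8 ≤? p + q
... | yes 8≤p+q = suc p , suc q , refl , refl , ΛCell⇒Λ (upper p<8 q<8 8≤p+q)
... | no  8≰p+q = lower-covers a (≰⇒> 8≰p+q)
  where
  lower-covers : ∀ a → p + q < 8 → InBlock (lowerBlock a b) (8 * a + suc p) (8 * b + suc q)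
  lower-covers zero    p+q<8 = suc q , refl , digits⇒Δ p+q<8
  lower-covers (suc a) p+q<8 = 9 + p , suc q , 8*[1+a]+[1+p]≡8*a+[9+p] a p , refl , ΛCell⇒Λ (lower p+q<8)

InBlock⇒≡blockAt : ∀ {k} β a p b q → p < 8 → q < 8 → Valid k β →
  InBlock β (8 * a + suc p) (8 * b + suc q) → β ≡ blockAt a p b q
InBlock⇒≡blockAt (tri c) a p b q p<8 q<8 _ (zero , _ , (_ , () , _))
InBlock⇒≡blockAt (tri c) (suc a) p b q p<8 q<8 _ (suc q′ , _ , (_ , 1≤j , i+j≤9)) =
  contradiction (≤-trans (+-mono-≤ (9≤8*a+k (s≤s z≤n) (s≤s z≤n)) 1≤j) i+j≤9) (<-irrefl refl)
InBlock⇒≡blockAt (tri c) zero p b q p<8 q<8 _ (suc q′ , eqj , Δ) =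
  let p+q′<8     = Δ⇒digits Δ
      b≡c , q≡q′ = digits-injective q<8 (≤-<-trans (m≤n+m q′ p) p+q′<8) eqj
  in trans (cong tri (sym b≡c)) (sym (blockAt-lower 0 p b q (subst (λ q → p + q < 8) (sym q≡q′) p+q′<8)))
InBlock⇒≡blockAt (loz zero c) a p b q p<8 q<8 (() , _) _
InBlock⇒≡blockAt (loz (suc r) c) a p b q p<8 q<8 _ (i′ , j′ , eqi , eqj , l) with Λ⇒ΛCell l
... | upper {p′} {q′} p′<8 q′<8 8≤p′+q′ =
  let a≡r , p≡p′ = digits-injective p<8 p′<8 eqi
      b≡c , q≡q′ = digits-injective q<8 q′<8 eqj
  in trans (cong₂ (λ a b → loz (suc a) b) (sym a≡r) (sym b≡c))
           (sym (blockAt-upper a p b q (subst₂ (λ p q → 8 ≤ p + q) (sym p≡p′) (sym q≡q′) 8≤p′+q′)))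
... | lower {p′} {q′} p′+q′<8 =
  let a≡1+r , p≡p′ = digits-injective p<8 (≤-<-trans (m≤m+n p′ q′) p′+q′<8)
                       (trans eqi (sym (8*[1+a]+[1+p]≡8*a+[9+p] r p′)))
      b≡c , q≡q′   = digits-injective q<8 (≤-<-trans (m≤n+m q′ p′) p′+q′<8) eqj
  in trans (cong₂ lowerBlock (sym a≡1+r) (sym b≡c))
           (sym (blockAt-lower a p b q (subst₂ (λ p q → p + q < 8) (sym p≡p′) (sym q≡q′) p′+q′<8)))

2+8*m≤1+8*k⇒m<k : ∀ {m k} → 2 + 8 * m ≤ 1 + 8 * k → m < k
2+8*m≤1+8*k⇒m<k {m} {k} (s≤s 8*m<8*k) = *-cancelˡ-< 8 m k 8*m<8*k

blockAt-valid : ∀ k a p b q → (8 * a + suc p) + (8 * b + suc q) ≤ 8 * k + 1 → Valid k (blockAt a p b q)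
blockAt-valid k a p b q i+j≤8k+1 = valid (subst₂ _≤_ (digit-sum a p b q) (+-comm (8 * k) 1) i+j≤8k+1)
  where
  digit-sum : ∀ a p b q → (8 * a + suc p) + (8 * b + suc q) ≡ 2 + (8 * (a + b) + (p + q))
  digit-sum = solve-∀
  lower-valid : ∀ a → a + b < k → Valid k (lowerBlock a b)
  lower-valid zero    b<k   = b<k
  lower-valid (suc a) a+b<k = s≤s z≤n , a+b<k
  valid : 2 + (8 * (a + b) + (p + q)) ≤ 1 + 8 * k → Valid k (blockAt a p b q)
  valid i+j≤ with 8 ≤? p + q
  ... | yes 8≤p+q = s≤s z≤n , 2+8*m≤1+8*k⇒m<k (≤-trans (+-monoʳ-≤ 2 upper-bound) i+j≤)
    where
    upper-bound : 8 * suc (a + b) ≤ 8 * (a + b) + (p + q)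
    upper-bound = ≤-trans (≤-reflexive (trans (*-suc 8 (a + b)) (+-comm 8 (8 * (a + b)))))
                          (+-monoʳ-≤ (8 * (a + b)) 8≤p+q)
  ... | no _ = lower-valid a (2+8*m≤1+8*k⇒m<k (≤-trans (+-monoʳ-≤ 2 (m≤m+n (8 * (a + b)) (p + q))) i+j≤))

InTri-translate : ∀ {n N i j} a b → a + b + n ≤ N → InTri n i j → InTri N (a + i) (b + j)
InTri-translate {n} {N} {i} {j} a b a+b+n≤N (1≤i , 1≤j , i+j≤n+1) =
  ≤-trans 1≤i (m≤n+m i a) , ≤-trans 1≤j (m≤n+m j b) , (begin
    (a + i) + (b + j)  ≡⟨ interchange a i b j ⟩
    (a + b) + (i + j)  ≤⟨ +-monoʳ-≤ (a + b) i+j≤n+1 ⟩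
    (a + b) + (n + 1)  ≡⟨ +-assoc (a + b) n 1 ⟨
    a + b + n + 1      ≤⟨ +-monoˡ-≤ 1 a+b+n≤N ⟩
    N + 1              ∎)
  where open ≤-Reasoning

InBlock⇒InTri : ∀ k β → Valid k β → ∀ i j → InBlock β i j → InTri (8 * k) i j
InBlock⇒InTri k (tri c) c<k i j (j′ , refl , Δ) = InTri-translate 0 (8 * c) bound Δ
  where
  bound : 8 * c + 8 ≤ 8 * k
  bound = subst (_≤ 8 * k) (trans (*-suc 8 c) (+-comm 8 (8 * c))) (*-monoʳ-≤ 8 c<k)
InBlock⇒InTri k (loz (suc r) c) (_ , r+c<k) i j (i′ , j′ , refl , refl , l) =
  InTri-translate (8 * r) (8 * c) bound (Λ⊆InTri16 l)
  where
  rows+cols : ∀ r c → 8 * suc (suc r + c) ≡ 8 * r + 8 * c + 16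
  rows+cols = solve-∀
  bound : 8 * r + 8 * c + 16 ≤ 8 * k
  bound = subst (_≤ 8 * k) (rows+cols r c) (*-monoʳ-≤ 8 r+c<k)

disjointUnion : ∀ k → DisjointUnion k
disjointUnion k = InBlock⇒InTri k , covered , disjoint
  where
  covered : ∀ i j → InTri (8 * k) i j → Σ BlockIx λ β → Valid k β × InBlock β i j
  covered i j (1≤i , 1≤j , i+j≤) with base8 i 1≤i | base8 j 1≤j
  ... | digits a p p<8 | digits b q q<8 =
    blockAt a p b q , blockAt-valid k a p b q i+j≤ , blockAt-covers a p b q p<8 q<8
  disjoint : ∀ β β′ → Valid k β → Valid k β′ → ∀ i j → InBlock β i j → InBlock β′ i j → β ≡ β′
  disjoint β β′ v v′ i j m m′ with InBlock⇒InTri k β v i j m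
  ... | 1≤i , 1≤j , _ with base8 i 1≤i | base8 j 1≤j
  ... | digits a p p<8 | digits b q q<8 =
    trans (InBlock⇒≡blockAt β a p b q p<8 q<8 v m) (sym (InBlock⇒≡blockAt β′ a p b q p<8 q<8 v′ m′))

lemma1 : (∀ k → DisjointUnion k)
    × (TriEq (T 0) (nabla I) × (∀ c → 1 ≤ c → TriEq (T c) (nabla (P ((c ∸ 1) mod 3)))))
    × (∀ c → 4 ≤ c → LozEq (L 1 c) (L 1 (c ∸ 3)) × LozEq (L 2 c) (L 2 (c ∸ 3)))
    × (∀ r c → 3 ≤ r → 1 ≤ c → LozEq (L r c) (L 2 (idx3 r c)))
    × (∀ r → 5 ≤ r → LozEq (L r 0) (L (r ∸ 3) 0))
    × LozEq (L 1 0) (triStar (nabla I) (nabla P1))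
    × LozEq (L 1 1) (triStar (nabla P1) (nabla P2))
    × LozEq (L 1 2) (triStar (nabla P2) (nabla P3))
    × LozEq (L 1 3) (triStar (nabla P3) (nabla P1))
    × LozEq (L 2 0) (lozStar (L 1 0) (L 1 1))
    × LozEq (L 2 1) (lozStar (L 1 1) (L 1 2))
    × LozEq (L 2 2) (lozStar (L 1 2) (L 1 3))
    × LozEq (L 2 3) (lozStar (L 1 3) (L 1 1))
    × LozEq (L 3 0) (lozStar (L 2 0) (L 2 1))
    × LozEq (L 4 0) (lozStar (L 3 0) (L 2 3))
lemma1 =
    disjointUnion
  , (T0≡∇I , T≡∇P)
  , (λ c 4≤c → L-col-periodic 1 c 4≤c , L-col-periodic 2 c 4≤c)
  , L-col≡idx3
  , (λ r → L-row-periodic r 0)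
  , L-triStar 0 (nabla I) (nabla P1) T0≡∇I (T≡∇P 1 (s≤s z≤n))
  , L-triStar 1 (nabla P1) (nabla P2) (T≡∇P 1 (s≤s z≤n)) (T≡∇P 2 (s≤s z≤n))
  , L-triStar 2 (nabla P2) (nabla P3) (T≡∇P 2 (s≤s z≤n)) (T≡∇P 3 (s≤s z≤n))
  , L-triStar 3 (nabla P3) (nabla P1) (T≡∇P 3 (s≤s z≤n)) (T≡∇P 4 (s≤s z≤n))
  , L-lozStar 1 2 0 1 1 refl (s≤s z≤n) (λ _ _ _ → refl)
  , L-lozStar 1 2 1 1 2 refl (s≤s z≤n) (λ _ _ _ → refl)
  , L-lozStar 1 2 2 1 3 refl (s≤s z≤n) (λ _ _ _ → refl)
  , L-lozStar 1 2 3 1 1 refl (s≤s z≤n) (λ k _ _ → sym (X-col-periodic (8 + k) 9 (s≤s z≤n) ≤-refl))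
  , L-lozStar 2 3 0 2 1 refl (s≤s z≤n) (λ _ _ _ → refl)
  , L-lozStar 3 4 0 2 3 refl (s≤s z≤n) (λ k _ _ →
      trans (sym (X-diagonal (16 + k) 25 (m≤m+n 9 (7 + k)) (m≤m+n 9 16))) (X-col-periodic (24 + k) 9 (s≤s z≤n) ≤-refl))
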